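{- Let $(x,y)$ be feasible for the linear system (L1)–(L6) below, and let $\mathcal{T}=(T_1,\dots,T_m)$ be any collection of disjoint complete neighborhood sets, with $J_\ell\subseteq C$ a client set responsible for $T_\ell$. Let $\mathcal{I}_{\mathcal T}$ be the instance of $Q||C_{\min}$ with $m$ machines, machine $\ell$ having demand $D_\ell=|J_\ell|$, and job types with capacities $c_1,\dots,c_P$. Define $y^{\mathcal T}_p:=\sum_{i\in T_1\cup\dots\cup T_m}y_{ip}$ for $p\in[P]$. Then $y^{\mathcal T}=(y^{\mathcal T}_1,\dots,y^{\mathcal T}_P)\in\mathcal{P}_{\mathrm{ass}}(\mathcal{I}_{\mathcal T})$.
   Context: Instance of the Heterogeneous Capacitated $k$-Center problem: finite metric space $(X=F\cup C,d)$ with clients $C$, facility locations $F$, and capacities $(k_1,c_1),\dots,(k_P,c_P)$. Fix $\mathrm{OPT}>0$; $G$ is the bipartite graph on $F\cup C$ with edge $(i,j)$ iff $d(i,j)\le\mathrm{OPT}$, and $\Gamma(S)$ is the set of $G$-neighbors of $S$. A set $T\subseteq F$ is a complete neighborhood if there is $J\subseteq C$ with $\Gamma(J)\subseteq T$; $J$ is then responsible for $T$. The system (L1)–(L6) on variables $x_{ijp},y_{ip}$ ($i\in F,j\in C,p\in[P]$), with $x_{ijp}=0$ whenever $d(i,j)>\mathrm{OPT}$: (L1) $\sum_{i\in F}\sum_p x_{ijp}\ge1$ for all $j$; (L2) $\sum_{j\in C}x_{ijp}\le c_py_{ip}$ for all $i,p$; (L3) $\sum_{i\in F}y_{ip}\le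 k_p$ for all $p$; (L4) $x_{ijp}\le y_{ip}$; (L5) $\sum_p y_{ip}\le1$ for all $i$; (L6) $x,y\ge0$. For an instance of $Q||C_{\min}$ with machine set $M$, demands $D_\ell$, and job types $p$ with capacities $c_p$, $\mathcal{P}_{\mathrm{ass}}$ is the set of vectors $s$ for which there exist $z_{\ell p}\ge0$ with $\sum_{\ell\in M}z_{\ell p}\le s_p$ for all $p$ and $\sum_p z_{\ell p}\min(c_p,D_\ell)\ge D_\ell$ for all $\ell\in M$.
   Formalization: The distances $d$, the value $\mathrm{OPT}$ and the feasible solution $(x,y)$ of (L1)–(L6) are rational. -}

module Defs where

open import Data.Nat using (ℕ; zero; suc) renaming (_⊓_ to _⊓ℕ_)
open import Data.Fin using (Fin; zero; suc)
open import Data.Fin.Subset using (Subset; Side; inside; outside; _∈_; _∉_; _⊆_; ⋃; ∣_∣)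
open import Data.Vec using (lookup)
open import Data.List using (List; tabulate)
open import Data.Integer using (+_)
open import Data.Rational using (ℚ; 0ℚ; _+_; _*_; _≤_; _<_; _/_)
open import Data.Product using (Σ; _×_; ∃; ∃-syntax)
open import Relation.Binary.PropositionalEquality using (_≡_; _≢_)

ℕ→ℚ : ℕ → ℚ
ℕ→ℚ n = + n / 1

Σ[<_] : (n : ℕ) → (Fin n → ℚ) → ℚ
Σ[< zero ] f = 0ℚ
Σ[< suc n ] f = f zero + Σ[< n ] (λ i → f (suc i))

sel : Side → ℚ → ℚ
sel inside q = q
sel outside q = 0ℚ

Σ∈ : {n : ℕ} → Subset n → (Fin n → ℚ) → ℚ
Σ∈ {n} S f = Σ[< n ] (λ i → sel (lookup S i) (f i))

record IsMetric (n : ℕ) (d : Fin n → Fin n → ℚ) : Set where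
  field
    nonneg : ∀ a b → 0ℚ ≤ d a b
    zero-iff : ∀ a b → (d a b ≡ 0ℚ → a ≡ b) × (a ≡ b → d a b ≡ 0ℚ)
    symm : ∀ a b → d a b ≡ d b a
    triangle : ∀ a b c → d a c ≤ d a b + d b c

-- Instance data: metric space (X = Fin n, d), facilities F ⊆ X, clients C ⊆ X,
-- P capacity types (k p, c p), and the guess OPT.
-- Edge (i,j) of G (i ∈ F, j ∈ C) iff d i j ≤ OPT.

-- The linear system (L1)–(L6).  Variables x i j p, y i p are given for all
-- points but only those with i ∈ F, j ∈ C are relevant (sums range over F, C).
record LPFeasible (n P : ℕ) (d : Fin n → Fin n → ℚ) (F C : Subset n)
                  (k c : Fin P → ℕ) (OPT : ℚ)
                  (x : Fin n → Fin n → Fin P → ℚ) (y : Fin n → Fin P → ℚ) : Set where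
  field
    x-zero : ∀ i j p → i ∈ F → j ∈ C → OPT < d i j → x i j p ≡ 0ℚ
    L1 : ∀ j → j ∈ C → ℕ→ℚ 1 ≤ Σ∈ F (λ i → Σ[< P ] (λ p → x i j p))
    L2 : ∀ i p → i ∈ F → Σ∈ C (λ j → x i j p) ≤ ℕ→ℚ (c p) * y i p
    L3 : ∀ p → Σ∈ F (λ i → y i p) ≤ ℕ→ℚ (k p)
    L4 : ∀ i j p → i ∈ F → j ∈ C → x i j p ≤ y i p
    L5 : ∀ i → i ∈ F → Σ[< P ] (λ p → y i p) ≤ ℕ→ℚ 1
    L6x : ∀ i j p → i ∈ F → j ∈ C → 0ℚ ≤ x i j p
    L6y : ∀ i p → i ∈ F → 0ℚ ≤ y i p

-- J ⊆ C is responsible for T ⊆ F:  Γ(J) ⊆ T, where Γ(J) is the set of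
-- facilities i ∈ F with d i j ≤ OPT for some j ∈ J.
Responsible : {n : ℕ} → (d : Fin n → Fin n → ℚ) → (F C : Subset n) → ℚ →
              (J T : Subset n) → Set
Responsible d F C OPT J T =
  J ⊆ C × T ⊆ F × (∀ i j → i ∈ F → j ∈ J → d i j ≤ OPT → i ∈ T)

CompleteNeighborhood : {n : ℕ} → (d : Fin n → Fin n → ℚ) → (F C : Subset n) → ℚ →
                       Subset n → Set
CompleteNeighborhood d F C OPT T = ∃[ J ] Responsible d F C OPT J T

InPass : (m P : ℕ) → (D : Fin m → ℕ) → (c : Fin P → ℕ) → (s : Fin P → ℚ) → Set
InPass m P D c s =
  Σ (Fin m → Fin P → ℚ) λ z → ((∀ ℓ p → 0ℚ ≤ z ℓ p)
        × (∀ p → Σ[< m ] (λ ℓ → z ℓ p) ≤ s p)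
        × (∀ ℓ → ℕ→ℚ (D ℓ) ≤ Σ[< P ] (λ p → z ℓ p * ℕ→ℚ (c p ⊓ℕ D ℓ))))

⋃ᶠ : {n m : ℕ} → (Fin m → Subset n) → Subset n
⋃ᶠ T = ⋃ (tabulate T)

-- Take z ℓ p := Σ_{i ∈ T ℓ} y i p.  Disjointness makes Σ_ℓ z ℓ p equal to y^𝒯 p.  For the demand
-- of machine ℓ, every client j ∈ J ℓ has all its G-neighbours in T ℓ, so (L1) gives
-- |J ℓ| ≤ Σ_{j ∈ J ℓ} Σ_{i ∈ T ℓ} Σ_p x i j p, and for each facility i ∈ T ℓ the flow
-- Σ_{j ∈ J ℓ} x i j p is at most c_p y i p by (L2) and at most |J ℓ| y i p by (L4).
module Submission where

open import Defs
open import Data.Nat using (ℕ; zero; suc) renaming (_⊓_ to _⊓ℕ_)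
import Data.Nat.Properties as ℕ
open import Data.Fin using (Fin; zero; suc)
open import Data.Fin.Properties using (suc-injective)
open import Data.Fin.Subset using (Subset; inside; outside; _∈_; _∉_; _⊆_; ∣_∣)
open import Data.Vec using ([]; _∷_; lookup)
open import Data.Vec.Properties using (lookup⇒[]=; []=⇒lookup; lookup-zipWith; lookup-replicate)
open import Data.Bool using (_∨_)
import Data.Integer as ℤ
import Data.Integer.Properties as ℤₚ
open import Data.Rational using (ℚ; 0ℚ; 1ℚ; _+_; _*_; _≤_; _<_; mkℚ)
open import Data.Rational.Properties
import Data.Rational.Unnormalised.Properties as ℚᵘ
open import Data.Rational.Unnormalised.Base using (*≡*)
open import Data.Nat.Coprimality using (1-coprimeTo) renaming (sym to coprime-sym)
open import Data.Product using (_,_; proj₁; proj₂)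
open import Data.Sum using (inj₁; inj₂)
open import Data.Empty using (⊥-elim)
open import Relation.Nullary using (yes; no)
open import Relation.Binary.PropositionalEquality
  using (_≡_; _≢_; refl; sym; trans; cong; cong₂; subst; module ≡-Reasoning)
open import Algebra.Bundles using (CommutativeMonoid)
open import Algebra.Properties.CommutativeSemigroup
  (CommutativeMonoid.commutativeSemigroup +-0-commutativeMonoid) using (interchange)

-- The normal form of n / 1, on which toℚᵘ computes.
n/1 : ℕ → ℚ
n/1 n = mkℚ (ℤ.+ n) 0 (coprime-sym (1-coprimeTo n))

ℕ→ℚ≡n/1 : ∀ n → ℕ→ℚ n ≡ n/1 n
ℕ→ℚ≡n/1 n = ↥p/↧p≡p (n/1 n)

ℕ→ℚ-suc : ∀ n → ℕ→ℚ (suc n) ≡ 1ℚ + ℕ→ℚ n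
ℕ→ℚ-suc n rewrite ℕ→ℚ≡n/1 (suc n) | ℕ→ℚ≡n/1 n =
  toℚᵘ-injective (ℚᵘ.≃-trans (*≡* numerators) (ℚᵘ.≃-sym (toℚᵘ-homo-+ 1ℚ (n/1 n))))
  where
  numerators : ℤ.+ suc n ℤ.* ℤ.+ 1 ≡ (ℤ.+ 1 ℤ.* ℤ.+ 1 ℤ.+ ℤ.+ n ℤ.* ℤ.+ 1) ℤ.* ℤ.+ 1
  numerators rewrite ℤₚ.*-identityʳ (ℤ.+ n) | ℤₚ.*-identityʳ (ℤ.+ suc n) = refl

Σ-cong : ∀ n {f g : Fin n → ℚ} → (∀ i → f i ≡ g i) → Σ[< n ] f ≡ Σ[< n ] g
Σ-cong zero    f≡g = refl
Σ-cong (suc n) f≡g = cong₂ _+_ (f≡g zero) (Σ-cong n (λ i → f≡g (suc i)))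

Σ-mono-≤ : ∀ n {f g : Fin n → ℚ} → (∀ i → f i ≤ g i) → Σ[< n ] f ≤ Σ[< n ] g
Σ-mono-≤ zero    f≤g = ≤-refl
Σ-mono-≤ (suc n) f≤g = +-mono-≤ (f≤g zero) (Σ-mono-≤ n (λ i → f≤g (suc i)))

Σ-zero : ∀ n {f : Fin n → ℚ} → (∀ i → f i ≡ 0ℚ) → Σ[< n ] f ≡ 0ℚ
Σ-zero zero    f≡0 = refl
Σ-zero (suc n) f≡0 =
  trans (cong₂ _+_ (f≡0 zero) (Σ-zero n (λ i → f≡0 (suc i)))) (+-identityʳ 0ℚ)

Σ-distrib-+ : ∀ n (f g : Fin n → ℚ) → Σ[< n ] (λ i → f i + g i) ≡ Σ[< n ] f + Σ[< n ] g
Σ-distrib-+ zero    f g = sym (+-identityʳ 0ℚ)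
Σ-distrib-+ (suc n) f g =
  trans (cong ((f zero + g zero) +_) (Σ-distrib-+ n (λ i → f (suc i)) (λ i → g (suc i))))
        (interchange (f zero) (g zero) _ _)

Σ-comm : ∀ n m (f : Fin n → Fin m → ℚ) →
         Σ[< n ] (λ i → Σ[< m ] (f i)) ≡ Σ[< m ] (λ j → Σ[< n ] (λ i → f i j))
Σ-comm zero    m f = sym (Σ-zero m (λ _ → refl))
Σ-comm (suc n) m f =
  trans (cong (Σ[< m ] (f zero) +_) (Σ-comm n m (λ i → f (suc i))))
        (sym (Σ-distrib-+ m (f zero) _))

Σ-distribʳ-* : ∀ n (f : Fin n → ℚ) a → Σ[< n ] (λ i → f i * a) ≡ Σ[< n ] f * a
Σ-distribʳ-* zero    f a = sym (*-zeroˡ a)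
Σ-distribʳ-* (suc n) f a =
  trans (cong (f zero * a +_) (Σ-distribʳ-* n (λ i → f (suc i)) a))
        (sym (*-distribʳ-+ a (f zero) _))

sel-Σ : ∀ s n (f : Fin n → ℚ) → sel s (Σ[< n ] f) ≡ Σ[< n ] (λ i → sel s (f i))
sel-Σ inside  n f = refl
sel-Σ outside n f = sym (Σ-zero n (λ _ → refl))

sel-*ˡ : ∀ s a b → sel s (a * b) ≡ sel s a * b
sel-*ˡ inside  a b = refl
sel-*ˡ outside a b = sym (*-zeroˡ b)

sel-comm : ∀ s t q → sel s (sel t q) ≡ sel t (sel s q)
sel-comm inside  inside  q = refl
sel-comm inside  outside q = refl
sel-comm outside inside  q = refl
sel-comm outside outside q = refl

∈⇒lookup≡inside : ∀ {n} {S : Subset n} {i} → i ∈ S → lookup S i ≡ inside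
∈⇒lookup≡inside = []=⇒lookup

∉⇒lookup≡outside : ∀ {n} (S : Subset n) i → i ∉ S → lookup S i ≡ outside
∉⇒lookup≡outside S i i∉S with lookup S i in eq
... | inside  = ⊥-elim (i∉S (lookup⇒[]= i S eq))
... | outside = refl

lookup≡outside⇒∉ : ∀ {n} {S : Subset n} {i} → lookup S i ≡ outside → i ∉ S
lookup≡outside⇒∉ eq i∈S with () ← trans (sym (∈⇒lookup≡inside i∈S)) eq

sel-pointwise : ∀ {n} (S : Subset n) (R : ℚ → ℚ → Set) → R 0ℚ 0ℚ → {f g : Fin n → ℚ} →
                (∀ i → i ∈ S → R (f i) (g i)) → ∀ i → R (sel (lookup S i) (f i)) (sel (lookup S i) (g i))
sel-pointwise S R R00 fRg i with lookup S i in eq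
... | inside  = fRg i (lookup⇒[]= i S eq)
... | outside = R00

Σ∈-cong : ∀ {n} (S : Subset n) {f g : Fin n → ℚ} → (∀ i → i ∈ S → f i ≡ g i) → Σ∈ S f ≡ Σ∈ S g
Σ∈-cong {n} S f≡g = Σ-cong n (sel-pointwise S _≡_ refl f≡g)

Σ∈-mono-≤ : ∀ {n} (S : Subset n) {f g : Fin n → ℚ} → (∀ i → i ∈ S → f i ≤ g i) → Σ∈ S f ≤ Σ∈ S g
Σ∈-mono-≤ {n} S f≤g = Σ-mono-≤ n (sel-pointwise S _≤_ ≤-refl f≤g)

Σ∈-const : ∀ {n} (S : Subset n) a → Σ∈ S (λ _ → a) ≡ ℕ→ℚ ∣ S ∣ * a
Σ∈-const []            a = sym (*-zeroˡ a)
Σ∈-const (outside ∷ S) a = trans (+-identityˡ _) (Σ∈-const S a)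
Σ∈-const (inside ∷ S)  a = begin
  a + Σ∈ S (λ _ → a)         ≡⟨ cong₂ _+_ (sym (*-identityˡ a)) (Σ∈-const S a) ⟩
  1ℚ * a + ℕ→ℚ ∣ S ∣ * a     ≡⟨ *-distribʳ-+ a 1ℚ (ℕ→ℚ ∣ S ∣) ⟨
  (1ℚ + ℕ→ℚ ∣ S ∣) * a       ≡⟨ cong (_* a) (ℕ→ℚ-suc ∣ S ∣) ⟨
  ℕ→ℚ (suc ∣ S ∣) * a        ∎
  where open ≡-Reasoning

Σ∈-nonneg : ∀ {n} (S : Subset n) {f : Fin n → ℚ} → (∀ i → i ∈ S → 0ℚ ≤ f i) → 0ℚ ≤ Σ∈ S f
Σ∈-nonneg S {f} 0≤f = subst (_≤ Σ∈ S f) Σ∈0≡0 (Σ∈-mono-≤ S 0≤f)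
  where
  Σ∈0≡0 : Σ∈ S (λ _ → 0ℚ) ≡ 0ℚ
  Σ∈0≡0 = trans (Σ∈-const S 0ℚ) (*-zeroʳ (ℕ→ℚ ∣ S ∣))

Σ∈-distribʳ-* : ∀ {n} (S : Subset n) (f : Fin n → ℚ) a → Σ∈ S (λ i → f i * a) ≡ Σ∈ S f * a
Σ∈-distribʳ-* {n} S f a =
  trans (Σ-cong n (λ i → sel-*ˡ (lookup S i) (f i) a)) (Σ-distribʳ-* n _ a)

Σ∈-Σ-comm : ∀ {n} P (S : Subset n) (f : Fin n → Fin P → ℚ) →
            Σ∈ S (λ i → Σ[< P ] (f i)) ≡ Σ[< P ] (λ p → Σ∈ S (λ i → f i p))
Σ∈-Σ-comm {n} P S f = trans (Σ-cong n (λ i → sel-Σ (lookup S i) P (f i))) (Σ-comm n P _)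

Σ∈-comm : ∀ {n} (S U : Subset n) (f : Fin n → Fin n → ℚ) →
          Σ∈ S (λ j → Σ∈ U (λ i → f i j)) ≡ Σ∈ U (λ i → Σ∈ S (λ j → f i j))
Σ∈-comm {n} S U f = begin
  Σ[< n ] (λ j → sel (lookup S j) (Σ[< n ] (λ i → sel (lookup U i) (f i j))))
    ≡⟨ Σ-cong n (λ j → sel-Σ (lookup S j) n _) ⟩
  Σ[< n ] (λ j → Σ[< n ] (λ i → sel (lookup S j) (sel (lookup U i) (f i j))))
    ≡⟨ Σ-comm n n _ ⟩
  Σ[< n ] (λ i → Σ[< n ] (λ j → sel (lookup S j) (sel (lookup U i) (f i j))))
    ≡⟨ Σ-cong n (λ i → Σ-cong n (λ j → sel-comm (lookup S j) (lookup U i) (f i j))) ⟩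
  Σ[< n ] (λ i → Σ[< n ] (λ j → sel (lookup U i) (sel (lookup S j) (f i j))))
    ≡⟨ Σ-cong n (λ i → sel-Σ (lookup U i) n _) ⟨
  Σ[< n ] (λ i → sel (lookup U i) (Σ[< n ] (λ j → sel (lookup S j) (f i j))))
    ∎
  where open ≡-Reasoning

Σ∈-⊆-mono-≤ : ∀ {n} {S U : Subset n} (f : Fin n → ℚ) → S ⊆ U → (∀ i → i ∈ U → 0ℚ ≤ f i) →
              Σ∈ S f ≤ Σ∈ U f
Σ∈-⊆-mono-≤ {n} {S} {U} f S⊆U 0≤f = Σ-mono-≤ n summand
  where
  summand : ∀ i → sel (lookup S i) (f i) ≤ sel (lookup U i) (f i)
  summand i with lookup S i in eqS | lookup U i in eqU
  ... | inside  | inside  = ≤-refl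
  ... | inside  | outside = ⊥-elim (lookup≡outside⇒∉ eqU (S⊆U (lookup⇒[]= i S eqS)))
  ... | outside | inside  = 0≤f i (lookup⇒[]= i U eqU)
  ... | outside | outside = ≤-refl

Σ∈-⊆-vanishing : ∀ {n} {S U : Subset n} (f : Fin n → ℚ) → S ⊆ U → (∀ i → i ∈ U → i ∉ S → f i ≡ 0ℚ) →
                 Σ∈ U f ≡ Σ∈ S f
Σ∈-⊆-vanishing {n} {S} {U} f S⊆U f≡0 = Σ-cong n summand
  where
  summand : ∀ i → sel (lookup U i) (f i) ≡ sel (lookup S i) (f i)
  summand i with lookup S i in eqS | lookup U i in eqU
  ... | inside  | inside  = refl
  ... | inside  | outside = ⊥-elim (lookup≡outside⇒∉ eqU (S⊆U (lookup⇒[]= i S eqS)))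
  ... | outside | inside  = f≡0 i (lookup⇒[]= i U eqU) (lookup≡outside⇒∉ eqS)
  ... | outside | outside = refl

Disjoint : ∀ {n m} → (Fin m → Subset n) → Set
Disjoint {m = m} T = ∀ (ℓ ℓ′ : Fin m) → ℓ ≢ ℓ′ → ∀ i → i ∈ T ℓ → i ∉ T ℓ′

sel-⋃ᶠ : ∀ {n} m (T : Fin m → Subset n) → Disjoint T → ∀ i a →
         Σ[< m ] (λ ℓ → sel (lookup (T ℓ) i) a) ≡ sel (lookup (⋃ᶠ T) i) a
sel-⋃ᶠ zero T _ i a rewrite lookup-replicate i outside = refl
sel-⋃ᶠ (suc m) T disjoint i a
  rewrite lookup-zipWith _∨_ i (T zero) (⋃ᶠ (λ ℓ → T (suc ℓ))) with lookup (T zero) i in eq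
... | inside  = trans (cong (a +_) (Σ-zero m outsideRest)) (+-identityʳ a)
  where
  outsideRest : ∀ ℓ → sel (lookup (T (suc ℓ)) i) a ≡ 0ℚ
  outsideRest ℓ rewrite ∉⇒lookup≡outside (T (suc ℓ)) i
    (disjoint zero (suc ℓ) (λ ()) i (lookup⇒[]= i (T zero) eq)) = refl
... | outside = trans (+-identityˡ _)
  (sel-⋃ᶠ m (λ ℓ → T (suc ℓ)) (λ ℓ ℓ′ ℓ≢ℓ′ → disjoint (suc ℓ) (suc ℓ′) (λ eq → ℓ≢ℓ′ (suc-injective eq))) i a)

Σ-Σ∈-⋃ᶠ : ∀ {n m} (T : Fin m → Subset n) → Disjoint T → (f : Fin n → ℚ) →
          Σ[< m ] (λ ℓ → Σ∈ (T ℓ) f) ≡ Σ∈ (⋃ᶠ T) f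
Σ-Σ∈-⋃ᶠ {n} {m} T disjoint f =
  trans (Σ-comm m n _) (Σ-cong n (λ i → sel-⋃ᶠ m T disjoint i (f i)))

module _ {n P : ℕ} {d : Fin n → Fin n → ℚ} {F C : Subset n} {k c : Fin P → ℕ} {OPT : ℚ}
         {x : Fin n → Fin n → Fin P → ℚ} {y : Fin n → Fin P → ℚ}
         (lp : LPFeasible n P d F C k c OPT x y) where

  open LPFeasible lp

  x-vanishes-outside : ∀ {J T} → Responsible d F C OPT J T →
                       ∀ i j p → i ∈ F → i ∉ T → j ∈ J → x i j p ≡ 0ℚ
  x-vanishes-outside (J⊆C , _ , Γ[J]⊆T) i j p i∈F i∉T j∈J = x-zero i j p i∈F (J⊆C j∈J) far
    where
    far : OPT < d i j
    far with d i j ≤? OPT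
    ... | yes near = ⊥-elim (i∉T (Γ[J]⊆T i j i∈F j∈J near))
    ... | no  ¬near = ≰⇒> ¬near

  demand-≤-flow : ∀ {J T} → Responsible d F C OPT J T →
                  ℕ→ℚ ∣ J ∣ ≤ Σ∈ T (λ i → Σ[< P ] (λ p → Σ∈ J (λ j → x i j p)))
  demand-≤-flow {J} {T} resp@(J⊆C , T⊆F , _) = begin
    ℕ→ℚ ∣ J ∣                                           ≡⟨ *-identityʳ (ℕ→ℚ ∣ J ∣) ⟨
    ℕ→ℚ ∣ J ∣ * 1ℚ                                      ≡⟨ Σ∈-const J 1ℚ ⟨
    Σ∈ J (λ _ → 1ℚ)                                      ≤⟨ Σ∈-mono-≤ J (λ j j∈J → L1 j (J⊆C j∈J)) ⟩
    Σ∈ J (λ j → Σ∈ F (λ i → xᵢⱼ i j))                    ≡⟨ Σ∈-cong J (λ j j∈J → Σ∈-⊆-vanishing (λ i → xᵢⱼ i j) T⊆F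
                                                              (λ i i∈F i∉T → Σ-zero P (λ p →
                                                                x-vanishes-outside resp i j p i∈F i∉T j∈J))) ⟩
    Σ∈ J (λ j → Σ∈ T (λ i → xᵢⱼ i j))                    ≡⟨ Σ∈-comm J T xᵢⱼ ⟩
    Σ∈ T (λ i → Σ∈ J (λ j → xᵢⱼ i j))                    ≡⟨ Σ∈-cong T (λ i _ → Σ∈-Σ-comm P J (x i)) ⟩
    Σ∈ T (λ i → Σ[< P ] (λ p → Σ∈ J (λ j → x i j p)))   ∎
    where
    open ≤-Reasoning
    xᵢⱼ : Fin n → Fin n → ℚ
    xᵢⱼ i j = Σ[< P ] (x i j)

  flow-≤ : ∀ {J} → J ⊆ C → ∀ i p → i ∈ F → Σ∈ J (λ j → x i j p) ≤ y i p * ℕ→ℚ (c p ⊓ℕ ∣ J ∣)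
  flow-≤ {J} J⊆C i p i∈F with ℕ.⊓-sel (c p) ∣ J ∣
  ... | inj₁ min≡c rewrite min≡c = begin
    Σ∈ J (λ j → x i j p)     ≤⟨ Σ∈-⊆-mono-≤ (λ j → x i j p) J⊆C (λ j j∈C → L6x i j p i∈F j∈C) ⟩
    Σ∈ C (λ j → x i j p)     ≤⟨ L2 i p i∈F ⟩
    ℕ→ℚ (c p) * y i p        ≡⟨ *-comm (ℕ→ℚ (c p)) (y i p) ⟩
    y i p * ℕ→ℚ (c p)        ∎
    where open ≤-Reasoning
  ... | inj₂ min≡∣J∣ rewrite min≡∣J∣ = begin
    Σ∈ J (λ j → x i j p)     ≤⟨ Σ∈-mono-≤ J (λ j j∈J → L4 i j p i∈F (J⊆C j∈J)) ⟩
    Σ∈ J (λ _ → y i p)       ≡⟨ Σ∈-const J (y i p) ⟩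
    ℕ→ℚ ∣ J ∣ * y i p        ≡⟨ *-comm (ℕ→ℚ ∣ J ∣) (y i p) ⟩
    y i p * ℕ→ℚ ∣ J ∣        ∎
    where open ≤-Reasoning

  demand-covered : ∀ {J T} → Responsible d F C OPT J T →
                   ℕ→ℚ ∣ J ∣ ≤ Σ[< P ] (λ p → Σ∈ T (λ i → y i p) * ℕ→ℚ (c p ⊓ℕ ∣ J ∣))
  demand-covered {J} {T} resp@(J⊆C , T⊆F , _) = begin
    ℕ→ℚ ∣ J ∣                                       ≤⟨ demand-≤-flow resp ⟩
    Σ∈ T (λ i → Σ[< P ] (λ p → Σ∈ J (λ j → x i j p)))
      ≤⟨ Σ∈-mono-≤ T (λ i i∈T → Σ-mono-≤ P (λ p → flow-≤ J⊆C i p (T⊆F i∈T))) ⟩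
    Σ∈ T (λ i → Σ[< P ] (λ p → y i p * w p))       ≡⟨ Σ∈-Σ-comm P T (λ i p → y i p * w p) ⟩
    Σ[< P ] (λ p → Σ∈ T (λ i → y i p * w p))       ≡⟨ Σ-cong P (λ p → Σ∈-distribʳ-* T (λ i → y i p) (w p)) ⟩
    Σ[< P ] (λ p → Σ∈ T (λ i → y i p) * w p)       ∎
    where
    open ≤-Reasoning
    w : Fin P → ℚ
    w p = ℕ→ℚ (c p ⊓ℕ ∣ J ∣)

lemma2 : (n P : ℕ) (d : Fin n → Fin n → ℚ) → IsMetric n d →
         (F C : Subset n) (k c : Fin P → ℕ) (OPT : ℚ) → 0ℚ < OPT →
         (x : Fin n → Fin n → Fin P → ℚ) (y : Fin n → Fin P → ℚ) →
         LPFeasible n P d F C k c OPT x y →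
         (m : ℕ) (T J : Fin m → Subset n) →
         (∀ ℓ ℓ′ → ℓ ≢ ℓ′ → ∀ i → i ∈ T ℓ → i ∉ T ℓ′) →
         (∀ ℓ → Responsible d F C OPT (J ℓ) (T ℓ)) →
         InPass m P (λ ℓ → ∣ J ℓ ∣) c (λ p → Σ∈ (⋃ᶠ T) (λ i → y i p))
lemma2 n P d _ F C k c OPT _ x y lp m T J disjoint resp =
  z , z-nonneg
    , (λ p → ≤-reflexive (Σ-Σ∈-⋃ᶠ T disjoint (λ i → y i p)))
    , (λ ℓ → demand-covered lp (resp ℓ))
  where
  z : Fin m → Fin P → ℚ
  z ℓ p = Σ∈ (T ℓ) (λ i → y i p)

  z-nonneg : ∀ ℓ p → 0ℚ ≤ z ℓ p
  z-nonneg ℓ p = Σ∈-nonneg (T ℓ) (λ i i∈T → LPFeasible.L6y lp i p (proj₁ (proj₂ (resp ℓ)) i∈T))
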